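{- Let $2k+1$ be a prime. If $G$ is a regular graph on $n$ vertices of degree $r>0$ that admits a $(2k+1)$-neighborhood balanced coloring, then $n\equiv 0 \pmod{2k+1}$ and $|E(G)|\equiv 0 \pmod{(2k+1)^2}$.
   Context: Graphs are finite and simple. For a prime $2k+1$ (with $k\ge 1$), a $(2k+1)$-neighborhood balanced coloring of a graph $G$ is an assignment to each vertex of one of $2k+1$ colors $R_1,\dots,R_{2k+1}$ such that every vertex has an equal number of neighbors of each color. -}

module Defs where

open import Data.Nat using (ℕ; suc; _<_; _<ᵇ_; _≡ᵇ_)
open import Data.Fin using (Fin; toℕ)
open import Data.Bool using (Bool; true; false; _∧_)
open import Data.Vec using (allFin; countᵇ; sum; map)
open import Relation.Binary.PropositionalEquality using (_≡_)

record Graph (n : ℕ) : Set where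
  field
    adj   : Fin n → Fin n → Bool
    sym   : ∀ u v → adj u v ≡ adj v u
    irrefl : ∀ v → adj v v ≡ false

open Graph public

degree : ∀ {n} → Graph n → Fin n → ℕ
degree G v = countᵇ (adj G v) (allFin _)

IsRegular : ∀ {n} → Graph n → ℕ → Set
IsRegular G r = ∀ v → degree G v ≡ r

_<ᵇF_ : ∀ {n} → Fin n → Fin n → Bool
i <ᵇF j = toℕ i <ᵇ toℕ j

edgeCount : ∀ {n} → Graph n → ℕ
edgeCount {n} G =
  sum (map (λ u → countᵇ (λ v → (u <ᵇF v) ∧ adj G u v) (allFin n)) (allFin n))

nbrsOfColour : ∀ {n m} → Graph n → (Fin n → Fin m) → Fin n → Fin m → ℕ
nbrsOfColour G c v a =
  countᵇ (λ u → adj G v u ∧ (toℕ (c u) ≡ᵇ toℕ a)) (allFin _)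

IsNeighbourhoodBalanced : ∀ {n m} → Graph n → (Fin n → Fin m) → Set
IsNeighbourhoodBalanced G c = ∀ v a b → nbrsOfColour G c v a ≡ nbrsOfColour G c v b

-- Double counting. Fix a colour class C. Since every neighbourhood meets each of the
-- m colour classes equally, deg v = m · |N(v) ∩ C|, so summing over v and swapping the
-- order of summation gives Σ_v deg v = m · Σ_{u ∈ C} deg u. Applying deg u = m · |N(u) ∩ C|
-- once more and the handshake lemma, 2|E| = m² · Σ_{u ∈ C} |N(u) ∩ C|, hence m² ∣ |E| as
-- m is odd. For an r-regular graph the same identity reads n · r = m · |C| · r, and
-- cancelling r > 0 gives n = m · |C|.
module Submission where

open import Defs hiding (sym)
open import Data.Nat using (ℕ; zero; suc; _+_; _*_; _>_; _≥_; _<ᵇ_; _≡ᵇ_; >-nonZero)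
open import Data.Nat.Properties
  using ( +-identityʳ; +-comm; *-comm; *-assoc; *-cancelʳ-≡; +-*-semiring
        ; <-asym; ≤-antisym; ≮⇒≥; <ᵇ-reflects-<)
open import Data.Nat.Primality using (Prime)
open import Data.Nat.Divisibility using (_∣_; ∣m+n∣m⇒∣n; ∣n⇒∣m*n; m∣m*n)
open import Data.Nat.Tactic.RingSolver using (solve-∀)
open import Data.Fin using (Fin; toℕ)
open import Data.Fin.Properties using (toℕ-injective)
open import Data.Bool using (Bool; true; false; _∧_)
open import Data.Vec as Vec using (tabulate; allFin; countᵇ)
open import Data.Vec.Properties using (tabulate-allFin)
open import Data.Product using (_×_; _,_)
open import Data.Empty using (⊥-elim)
open import Function using (id; _∘_)
open import Relation.Nullary.Reflects using (ofʸ; ofⁿ)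
open import Relation.Binary.PropositionalEquality
  using (_≡_; refl; sym; trans; cong; subst; module ≡-Reasoning)
open import Algebra.Properties.Semiring.Sum +-*-semiring
  using ( sum-syntax; sum-cong-≗; sum-replicate-zero; ∑-comm; ∑-distrib-+
        ; *-distribˡ-sum; *-distribʳ-sum)

open ≡-Reasoning

iverson : Bool → ℕ
iverson true  = 1
iverson false = 0

iverson-∧ : ∀ x y → iverson (x ∧ y) ≡ iverson x * iverson y
iverson-∧ true  y = sym (+-identityʳ (iverson y))
iverson-∧ false y = refl

∑-const : ∀ n x → ∑[ i < n ] x ≡ n * x
∑-const zero    x = refl
∑-const (suc n) x = cong (x +_) (∑-const n x)

∑-iverson-toℕ-≡ᵇ : ∀ {m} (x : Fin m) → ∑[ a < m ] iverson (toℕ x ≡ᵇ toℕ a) ≡ 1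
∑-iverson-toℕ-≡ᵇ {suc m} Fin.zero    = cong suc (sum-replicate-zero m)
∑-iverson-toℕ-≡ᵇ {suc m} (Fin.suc x) = ∑-iverson-toℕ-≡ᵇ x

sum-tabulate : ∀ {n} (f : Fin n → ℕ) → Vec.sum (tabulate f) ≡ ∑[ i < n ] f i
sum-tabulate {zero}  f = refl
sum-tabulate {suc n} f = cong (f Fin.zero +_) (sum-tabulate (f ∘ Fin.suc))

sum-map-allFin : ∀ {n} (f : Fin n → ℕ) → Vec.sum (Vec.map f (allFin n)) ≡ ∑[ i < n ] f i
sum-map-allFin f = trans (cong Vec.sum (sym (tabulate-allFin f))) (sum-tabulate f)

countᵇ-tabulate : ∀ {A : Set} {n} (p : A → Bool) (f : Fin n → A) →
                  countᵇ p (tabulate f) ≡ ∑[ i < n ] iverson (p (f i))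
countᵇ-tabulate {n = zero}  p f = refl
countᵇ-tabulate {n = suc n} p f with p (f Fin.zero)
... | true  = cong suc (countᵇ-tabulate p (f ∘ Fin.suc))
... | false = countᵇ-tabulate p (f ∘ Fin.suc)

countᵇ-allFin : ∀ {n} (p : Fin n → Bool) → countᵇ p (allFin n) ≡ ∑[ i < n ] iverson (p i)
countᵇ-allFin p = countᵇ-tabulate p id

odd∣2*x⇒∣x : ∀ j {x} → 2 * j + 1 ∣ 2 * x → 2 * j + 1 ∣ x
odd∣2*x⇒∣x j {x} d∣2x = ∣m+n∣m⇒∣n (subst (2 * j + 1 ∣_) (expand j x) (m∣m*n x)) (∣n⇒∣m*n j d∣2x)
  where
  expand : ∀ j x → (2 * j + 1) * x ≡ j * (2 * x) + x
  expand = solve-∀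

module _ {n} (G : Graph n) where

  degree≡∑ : ∀ v → degree G v ≡ ∑[ u < n ] iverson (adj G v u)
  degree≡∑ v = countᵇ-allFin (adj G v)

  -- Each edge uv is counted by edgeCount from its smaller endpoint only.
  iverson-adj-split : ∀ u v →
    iverson (adj G u v) ≡ iverson (u <ᵇF v ∧ adj G u v) + iverson (v <ᵇF u ∧ adj G v u)
  iverson-adj-split u v
    with toℕ u <ᵇ toℕ v | <ᵇ-reflects-< (toℕ u) (toℕ v)
       | toℕ v <ᵇ toℕ u | <ᵇ-reflects-< (toℕ v) (toℕ u)
  ... | _ | ofʸ u<v | _ | ofʸ v<u = ⊥-elim (<-asym u<v v<u)
  ... | _ | ofʸ _   | _ | ofⁿ _   = sym (+-identityʳ _)
  ... | _ | ofⁿ _   | _ | ofʸ _   = cong iverson (Graph.sym G u v)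
  ... | _ | ofⁿ u≮v | _ | ofⁿ v≮u
    rewrite toℕ-injective (≤-antisym (≮⇒≥ v≮u) (≮⇒≥ u≮v)) = cong iverson (irrefl G v)

  ∑-degree≡2*edgeCount : ∑[ v < n ] degree G v ≡ 2 * edgeCount G
  ∑-degree≡2*edgeCount = begin
    ∑[ u < n ] degree G u
      ≡⟨ sum-cong-≗ degree≡∑ ⟩
    ∑[ u < n ] ∑[ v < n ] iverson (adj G u v)
      ≡⟨ sum-cong-≗ (λ u → sum-cong-≗ (iverson-adj-split u)) ⟩
    ∑[ u < n ] ∑[ v < n ] (lower u v + lower v u)
      ≡⟨ sum-cong-≗ (λ u → ∑-distrib-+ (lower u) (λ v → lower v u)) ⟩
    ∑[ u < n ] (∑[ v < n ] lower u v + ∑[ v < n ] lower v u)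
      ≡⟨ ∑-distrib-+ (λ u → ∑[ v < n ] lower u v) (λ u → ∑[ v < n ] lower v u) ⟩
    E + ∑[ u < n ] ∑[ v < n ] lower v u
      ≡⟨ cong (E +_) (∑-comm (λ u v → lower v u)) ⟩
    E + E
      ≡⟨ cong (E +_) (sym (+-identityʳ E)) ⟩
    2 * E
      ≡⟨ cong (2 *_) (sym edgeCount≡E) ⟩
    2 * edgeCount G ∎
    where
    lower : Fin n → Fin n → ℕ
    lower u v = iverson (u <ᵇF v ∧ adj G u v)
    E : ℕ
    E = ∑[ u < n ] ∑[ v < n ] lower u v
    edgeCount≡E : edgeCount G ≡ E
    edgeCount≡E = trans (sum-map-allFin (λ u → countᵇ (λ v → u <ᵇF v ∧ adj G u v) (allFin n)))
                        (sum-cong-≗ (λ u → countᵇ-allFin (λ v → u <ᵇF v ∧ adj G u v)))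

  module _ {m} (c : Fin n → Fin m) where

    colourClass : Fin m → Fin n → Bool
    colourClass a u = toℕ (c u) ≡ᵇ toℕ a

    adjToColour : Fin n → Fin m → Fin n → Bool
    adjToColour v a u = adj G v u ∧ colourClass a u

    nbrsOfColour≡∑ : ∀ v a → nbrsOfColour G c v a ≡ ∑[ u < n ] iverson (adjToColour v a u)
    nbrsOfColour≡∑ v a = countᵇ-allFin (adjToColour v a)

    iverson-adj≡∑-colours : ∀ v u → iverson (adj G v u) ≡ ∑[ a < m ] iverson (adjToColour v a u)
    iverson-adj≡∑-colours v u with adj G v u
    ... | true  = sym (∑-iverson-toℕ-≡ᵇ (c u))
    ... | false = sym (sum-replicate-zero m)

    degree≡∑-nbrsOfColour : ∀ v → degree G v ≡ ∑[ a < m ] nbrsOfColour G c v a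
    degree≡∑-nbrsOfColour v = begin
      degree G v
        ≡⟨ degree≡∑ v ⟩
      ∑[ u < n ] iverson (adj G v u)
        ≡⟨ sum-cong-≗ (iverson-adj≡∑-colours v) ⟩
      ∑[ u < n ] ∑[ a < m ] iverson (adjToColour v a u)
        ≡⟨ ∑-comm (λ u a → iverson (adjToColour v a u)) ⟩
      ∑[ a < m ] ∑[ u < n ] iverson (adjToColour v a u)
        ≡⟨ sum-cong-≗ (λ a → sym (nbrsOfColour≡∑ v a)) ⟩
      ∑[ a < m ] nbrsOfColour G c v a ∎

    balanced⇒degree≡m*nbrsOfColour : IsNeighbourhoodBalanced G c →
                                     ∀ v a → degree G v ≡ m * nbrsOfColour G c v a
    balanced⇒degree≡m*nbrsOfColour balanced v a =
      trans (degree≡∑-nbrsOfColour v)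
            (trans (sum-cong-≗ (λ b → balanced v b a)) (∑-const m (nbrsOfColour G c v a)))

    ∑-nbrsOfColour≡∑-degree : ∀ a →
      ∑[ v < n ] nbrsOfColour G c v a ≡ ∑[ u < n ] (iverson (colourClass a u) * degree G u)
    ∑-nbrsOfColour≡∑-degree a = begin
      ∑[ v < n ] nbrsOfColour G c v a
        ≡⟨ sum-cong-≗ (λ v → nbrsOfColour≡∑ v a) ⟩
      ∑[ v < n ] ∑[ u < n ] iverson (adjToColour v a u)
        ≡⟨ ∑-comm (λ v u → iverson (adjToColour v a u)) ⟩
      ∑[ u < n ] ∑[ v < n ] iverson (adjToColour v a u)
        ≡⟨ sum-cong-≗ (λ u → sum-cong-≗ (iverson-adjToColour-transpose u)) ⟩
      ∑[ u < n ] ∑[ v < n ] (iverson (colourClass a u) * iverson (adj G u v))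
        ≡⟨ sum-cong-≗ (λ u → sym (*-distribˡ-sum (iverson (colourClass a u)) (λ v → iverson (adj G u v)))) ⟩
      ∑[ u < n ] (iverson (colourClass a u) * ∑[ v < n ] iverson (adj G u v))
        ≡⟨ sum-cong-≗ (λ u → cong (iverson (colourClass a u) *_) (sym (degree≡∑ u))) ⟩
      ∑[ u < n ] (iverson (colourClass a u) * degree G u) ∎
      where
      iverson-adjToColour-transpose : ∀ u v →
        iverson (adjToColour v a u) ≡ iverson (colourClass a u) * iverson (adj G u v)
      iverson-adjToColour-transpose u v = begin
        iverson (adjToColour v a u)
          ≡⟨ iverson-∧ (adj G v u) (colourClass a u) ⟩
        iverson (adj G v u) * iverson (colourClass a u)
          ≡⟨ *-comm (iverson (adj G v u)) (iverson (colourClass a u)) ⟩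
        iverson (colourClass a u) * iverson (adj G v u)
          ≡⟨ cong (λ x → iverson (colourClass a u) * iverson x) (Graph.sym G v u) ⟩
        iverson (colourClass a u) * iverson (adj G u v) ∎

    balanced⇒∑-degree≡m*∑-degree-of-colour : IsNeighbourhoodBalanced G c → ∀ a →
      ∑[ v < n ] degree G v ≡ m * ∑[ u < n ] (iverson (colourClass a u) * degree G u)
    balanced⇒∑-degree≡m*∑-degree-of-colour balanced a = begin
      ∑[ v < n ] degree G v
        ≡⟨ sum-cong-≗ (λ v → balanced⇒degree≡m*nbrsOfColour balanced v a) ⟩
      ∑[ v < n ] (m * nbrsOfColour G c v a)
        ≡⟨ sym (*-distribˡ-sum m (λ v → nbrsOfColour G c v a)) ⟩
      m * ∑[ v < n ] nbrsOfColour G c v a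
        ≡⟨ cong (m *_) (∑-nbrsOfColour≡∑-degree a) ⟩
      m * ∑[ u < n ] (iverson (colourClass a u) * degree G u) ∎

    balanced⇒m*m∣2*edgeCount : IsNeighbourhoodBalanced G c → Fin m → m * m ∣ 2 * edgeCount G
    balanced⇒m*m∣2*edgeCount balanced a = subst (m * m ∣_) m*m*X≡2*edgeCount (m∣m*n X)
      where
      inClass*nbrs : Fin n → ℕ
      inClass*nbrs u = iverson (colourClass a u) * nbrsOfColour G c u a
      X : ℕ
      X = ∑[ u < n ] inClass*nbrs u
      pull-m : ∀ u → iverson (colourClass a u) * degree G u ≡ m * inClass*nbrs u
      pull-m u = let x = iverson (colourClass a u) ; y = nbrsOfColour G c u a in begin
        x * degree G u   ≡⟨ cong (x *_) (balanced⇒degree≡m*nbrsOfColour balanced u a) ⟩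
        x * (m * y)      ≡⟨ sym (*-assoc x m y) ⟩
        x * m * y        ≡⟨ cong (_* y) (*-comm x m) ⟩
        m * x * y        ≡⟨ *-assoc m x y ⟩
        m * (x * y)      ∎
      m*m*X≡2*edgeCount : m * m * X ≡ 2 * edgeCount G
      m*m*X≡2*edgeCount = begin
        m * m * X
          ≡⟨ *-assoc m m X ⟩
        m * (m * X)
          ≡⟨ cong (m *_) (*-distribˡ-sum m inClass*nbrs) ⟩
        m * ∑[ u < n ] (m * inClass*nbrs u)
          ≡⟨ cong (m *_) (sum-cong-≗ (λ u → sym (pull-m u))) ⟩
        m * ∑[ u < n ] (iverson (colourClass a u) * degree G u)
          ≡⟨ sym (balanced⇒∑-degree≡m*∑-degree-of-colour balanced a) ⟩
        ∑[ v < n ] degree G v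
          ≡⟨ ∑-degree≡2*edgeCount ⟩
        2 * edgeCount G ∎

    balanced∧regular⇒m∣n : ∀ {r} → IsRegular G r → r > 0 → IsNeighbourhoodBalanced G c →
                           Fin m → m ∣ n
    balanced∧regular⇒m∣n {r} regular r>0 balanced a =
      subst (m ∣_) (sym (*-cancelʳ-≡ n (m * N) r {{>-nonZero r>0}} n*r≡m*N*r)) (m∣m*n N)
      where
      N : ℕ
      N = ∑[ u < n ] iverson (colourClass a u)
      n*r≡m*N*r : n * r ≡ m * N * r
      n*r≡m*N*r = begin
        n * r
          ≡⟨ sym (∑-const n r) ⟩
        ∑[ v < n ] r
          ≡⟨ sum-cong-≗ (λ v → sym (regular v)) ⟩
        ∑[ v < n ] degree G v
          ≡⟨ balanced⇒∑-degree≡m*∑-degree-of-colour balanced a ⟩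
        m * ∑[ u < n ] (iverson (colourClass a u) * degree G u)
          ≡⟨ cong (m *_) (sum-cong-≗ (λ u → cong (iverson (colourClass a u) *_) (regular u))) ⟩
        m * ∑[ u < n ] (iverson (colourClass a u) * r)
          ≡⟨ cong (m *_) (sym (*-distribʳ-sum r (λ u → iverson (colourClass a u)))) ⟩
        m * (N * r)
          ≡⟨ sym (*-assoc m N r) ⟩
        m * N * r ∎

corollary2p4 : (k n r : ℕ) → Prime (2 * k + 1) → k ≥ 1 →
    (G : Graph n) → IsRegular G r → r > 0 →
    (c : Fin n → Fin (2 * k + 1)) → IsNeighbourhoodBalanced G c →
    ((2 * k + 1) ∣ n) × ((2 * k + 1) * (2 * k + 1) ∣ edgeCount G)
corollary2p4 k n r _ _ G regular r>0 c balanced =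
  balanced∧regular⇒m∣n G c regular r>0 balanced colour , m*m∣edgeCount
  where
  colour : Fin (2 * k + 1)
  colour = subst Fin (+-comm 1 (2 * k)) Fin.zero
  odd-square : ∀ k → (2 * k + 1) * (2 * k + 1) ≡ 2 * (2 * k * k + 2 * k) + 1
  odd-square = solve-∀
  m*m∣2*edgeCount : 2 * (2 * k * k + 2 * k) + 1 ∣ 2 * edgeCount G
  m*m∣2*edgeCount = subst (_∣ 2 * edgeCount G) (odd-square k) (balanced⇒m*m∣2*edgeCount G c balanced colour)
  m*m∣edgeCount : (2 * k + 1) * (2 * k + 1) ∣ edgeCount G
  m*m∣edgeCount = subst (_∣ edgeCount G) (sym (odd-square k)) (odd∣2*x⇒∣x (2 * k * k + 2 * k) m*m∣2*edgeCount)
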